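{- Let $\mathcal{GO}=\langle t,\prec,\phi\rangle$ be a GOMT problem with $\phi$ satisfiable. Suppose $\mathcal{GO}$ has one or more optimal solutions and is not unbounded along any branch. Then every derivation generated by a progressive hybrid strategy, i.e., a progressive strategy for the calculus in which the call $\textsc{Solve}(\phi\wedge\psi)$ in the rule F-Sat is replaced by a call $\textsc{Optimize}(\phi\wedge\psi, t)$, ends with a saturated state whose interpretation component is an optimal solution of $\mathcal{GO}$.
   Context: Fix a many-sorted first-order theory $\mathcal{T}$ (a signature $\Sigma$ together with a class of $\Sigma$-interpretations, the $\mathcal{T}$-interpretations) with equality, and an infinite set of sorted variables; all interpretations considered are $\mathcal{T}$-interpretations assigning a value to every variable, and $\models$ means $\models_{\mathcal{T}}$. A GOMT problem is a triple $\mathcal{GO}=\langle t,\prec,\phi\rangle$ where $t$ is a $\Sigma$-term of some sort $\sigma$, $\prec$ is a strict partial order on the values of sort $\sigma$ definable in $\mathcal{T}$, and $\phi$ is a $\Sigma$-formula. $\mathcal{I}$ is $\mathcal{GO}$-consistent if $\mathcal{I}\models\phi$; $\mathcal{I}<_{\mathcal{GO}}\mathcal{I}'$ if both are $\mathcal{GO}$-consistent and $t^{\mathcal{I}}\prec t^{\mathcal{I}'}$; $\mathcal{I}$ is an optimal solution if it is $\mathcal{GO}$-consistent and no interpretation $\mathcal{J}$ satisfies $\mathcal{J}<_{\mathcal{GO}}\mathcal{I}$. $\textsc{Solve}$ maps a formula to an interpretation satisfying it if it is satisfiable, and to $\bot$ otherwise. $\textsc{Optimize}(\chi,t)$, for a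 formula $\chi$ (here of the form $\phi\wedge\psi$), returns an interpretation $\mathcal{I}'\models\chi$ such that no interpretation $\mathcal{J}\models\chi$ has $t^{\mathcal{J}}\prec t^{\mathcal{I}'}$ (an optimal solution within the branch $\chi$), and $\bot$ if $\chi$ is unsatisfiable. "Not unbounded along any branch" means that whenever the calculus calls $\textsc{Optimize}$ on a satisfiable branch $\phi\wedge\psi$, such an optimal solution within that branch exists. $\textsc{Better}$ maps each $\mathcal{GO}$-consistent $\mathcal{I}$ to a formula such that for every $\mathcal{GO}$-consistent $\mathcal{I}'$: $\mathcal{I}'\models\textsc{Better}(\mathcal{I})$ iff $\mathcal{I}'<_{\mathcal{GO}}\mathcal{I}$. For a finite sequence $S=(s_1,\dots,s_n)$, $\textsc{Top}(S)=s_1$, $\textsc{Pop}(S)=(s_2,\dots,s_n)$, $\emptyset$ is the empty sequence, $\circ$ is concatenation. A state is $\langle\mathcal{I},\Delta,\tau\rangle$ ($\mathcal{I}$ an interpretation, $\Delta$ a formula, $\tau$ a finite sequence of formulas). Initial state: $\mathcal{I}_0=\textsc{Solve}(\phi)$, $\Delta_0=\textsc{Better}(\mathcal{I}_0)$, $\tau_0=(\Delta_0)$. Rules (unmentioned components unchanged): F-Split: if $\tau\neq\emptyset$, $\psi=\textsc{Top}(\tau)$, $\phi\models\psi\Leftrightarrow\bigvee_{j=1}^k\psi_j$ with $k\ge1$, then $\tau:=(\psi_1,\dots,\psi_k)\circ\textsc{Pop}(\tau)$. F-Sat: if $\tau\neq\emptyset$, $\psi=\textsc{Top}(\tau)$,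 $\textsc{Solve}(\phi\wedge\psi)=\mathcal{I}'\neq\bot$, $\Delta'=\Delta\wedge\textsc{Better}(\mathcal{I}')$, then $\mathcal{I}:=\mathcal{I}'$, $\Delta:=\Delta'$, $\tau:=(\Delta')$. F-Close: if $\tau\neq\emptyset$, $\psi=\textsc{Top}(\tau)$, $\textsc{Solve}(\phi\wedge\psi)=\bot$, then $\Delta:=\Delta\wedge\neg\psi$, $\tau:=\textsc{Pop}(\tau)$. A rule applies if its premises hold and the resulting state differs; a state is saturated if no rule applies. A derivation is a sequence of states starting at the initial state, each obtained from the previous by one rule. A derivation strategy is progressive if it (i) never halts in a non-saturated state and (ii) uses F-Split only finitely many times in any derivation. -}

module Defs where

open import Data.Nat using (ℕ; suc; _≤_)
open import Data.List using (List; []; _∷_; _++_)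
open import Data.List.Relation.Unary.Any using (Any)
open import Data.Maybe using (Maybe; just; nothing)
open import Data.Product using (Σ; ∃; _×_; _,_)
open import Data.Empty using (⊥)
open import Data.Unit using (⊤)
open import Relation.Nullary using (¬_)
open import Relation.Binary.PropositionalEquality using (_≡_; _≢_)
open import Relation.Binary.Core using (Rel)
open import Relation.Binary.Structures using (IsStrictPartialOrder)
open import Relation.Binary.Construct.Closure.ReflexiveTransitive using (Star)
open import Function.Bundles using (_⇔_)

-- Formulas: the connectives the calculus builds (∧, ¬) are genuine
-- syntax; every other Σ-formula (φ, the outputs of Better, the ψ_j of
-- F-Split, …) is an abstract "atom" with an arbitrary T-semantics.

data Formula (Atom : Set) : Set where
  atom : Atom → Formula Atom
  _∧ᶠ_ : Formula Atom → Formula Atom → Formula Atom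
  ¬ᶠ_  : Formula Atom → Formula Atom

record Theory : Set₁ where
  field
    Interp : Set
    Atom   : Set
    _⊨ₐ_   : Interp → Atom → Set

module _ (T : Theory) where
  open Theory T

  _⊨_ : Interp → Formula Atom → Set
  I ⊨ atom a   = I ⊨ₐ a
  I ⊨ (a ∧ᶠ b) = (I ⊨ a) × (I ⊨ b)
  I ⊨ (¬ᶠ a)   = ¬ (I ⊨ a)

  Satisfiable : Formula Atom → Set
  Satisfiable χ = ∃ λ I → I ⊨ χ

  -- A GOMT problem ⟨t, ≺, φ⟩.  The term t is given through its
  -- valuation I ↦ t^I into the values of its sort σ.
  record GOMT : Set₁ where
    field
      Value   : Set
      _≺_     : Rel Value _
      ≺-spo   : IsStrictPartialOrder _≡_ _≺_
      t       : Interp → Value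
      φ       : Formula Atom

module _ {T : Theory} (G : GOMT T) where
  open Theory T
  open GOMT G

  private
    _⊨'_ = _⊨_ T

  Consistent : Interp → Set
  Consistent I = I ⊨' φ

  _<GO_ : Interp → Interp → Set
  I <GO I' = Consistent I × Consistent I' × (t I ≺ t I')

  Optimal : Interp → Set
  Optimal I = Consistent I × (∀ J → ¬ (J <GO I))

  OptimalIn : Formula Atom → Interp → Set
  OptimalIn χ I = I ⊨' χ × (∀ J → J ⊨' χ → ¬ (t J ≺ t I))

  SolveSpec : (Formula Atom → Maybe Interp) → Set
  SolveSpec Solve =
      (∀ χ I → Solve χ ≡ just I → I ⊨' χ)
    × (∀ χ → Solve χ ≡ nothing → ¬ Satisfiable T χ)

  OptimizeSpec : (Formula Atom → Maybe Interp) → Set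
  OptimizeSpec Optimize =
      (∀ χ I → Optimize χ ≡ just I → OptimalIn χ I)
    × (∀ χ → Optimize χ ≡ nothing → ¬ (∃ λ I → OptimalIn χ I))

  BetterSpec : (Interp → Formula Atom) → Set
  BetterSpec Better =
    ∀ I I' → Consistent I → Consistent I' → (I' ⊨' Better I ⇔ (I' <GO I))

  record State : Set where
    constructor ⟨_,_,_⟩
    field
      I : Interp
      Δ : Formula Atom
      τ : List (Formula Atom)

  module Hybrid (Solve Optimize : Formula Atom → Maybe Interp)
                (Better : Interp → Formula Atom) where

    IsInitial : State → Set
    IsInitial s = Σ Interp λ I₀ → Solve φ ≡ just I₀ × s ≡ ⟨ I₀ , Better I₀ , Better I₀ ∷ [] ⟩

    data Step : State → State → Set where
      F-Split : ∀ {I Δ ψ rest} (ψs : List (Formula Atom)) →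
                ψs ≢ [] →
                (∀ J → J ⊨' φ → (J ⊨' ψ ⇔ Any (J ⊨'_) ψs)) →
                ⟨ I , Δ , ψs ++ rest ⟩ ≢ ⟨ I , Δ , ψ ∷ rest ⟩ →
                Step ⟨ I , Δ , ψ ∷ rest ⟩ ⟨ I , Δ , ψs ++ rest ⟩
      F-Sat   : ∀ {I Δ ψ rest} I' →
                Optimize (φ ∧ᶠ ψ) ≡ just I' →
                ⟨ I' , Δ ∧ᶠ Better I' , (Δ ∧ᶠ Better I') ∷ [] ⟩ ≢ ⟨ I , Δ , ψ ∷ rest ⟩ →
                Step ⟨ I , Δ , ψ ∷ rest ⟩ ⟨ I' , Δ ∧ᶠ Better I' , (Δ ∧ᶠ Better I') ∷ [] ⟩
      F-Close : ∀ {I Δ ψ rest} →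
                Solve (φ ∧ᶠ ψ) ≡ nothing →
                ⟨ I , Δ ∧ᶠ (¬ᶠ ψ) , rest ⟩ ≢ ⟨ I , Δ , ψ ∷ rest ⟩ →
                Step ⟨ I , Δ , ψ ∷ rest ⟩ ⟨ I , Δ ∧ᶠ (¬ᶠ ψ) , rest ⟩

    IsSplit : ∀ {s s'} → Step s s' → Set
    IsSplit (F-Split _ _ _ _) = ⊤
    IsSplit (F-Sat _ _ _)     = ⊥
    IsSplit (F-Close _ _)     = ⊥

    Saturated : State → Set
    Saturated s = ∀ s' → ¬ Step s s'

    Reachable : State → Set
    Reachable s = ∃ λ s₀ → IsInitial s₀ × Star Step s₀ s

    -- "not unbounded along any branch": whenever the calculus would call
    -- Optimize(φ ∧ ψ, t) (ψ = Top(τ) at a reachable state) on a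
    -- satisfiable branch, an optimal solution within that branch exists.
    NotUnboundedAlongBranches : Set
    NotUnboundedAlongBranches =
      ∀ I Δ ψ rest → Reachable ⟨ I , Δ , ψ ∷ rest ⟩ →
        Satisfiable T (φ ∧ᶠ ψ) → ∃ λ J → OptimalIn (φ ∧ᶠ ψ) J

    record InfiniteDerivation : Set where
      field
        d          : ℕ → State
        initial    : IsInitial (d 0)
        step       : ∀ n → Step (d n) (d (suc n))
        splitBound : ℕ
        finSplits  : ∀ n → splitBound ≤ n → ¬ IsSplit (step n)

-- Once F-Split is no longer used, F-Close only shrinks the stack τ, and every F-Sat leaves the
-- state in the form ⟨I, Δ, (Δ)⟩. From such a state F-Sat returns an optimum I' within Δ, and a
-- further F-Sat would need a model of Δ ∧ Better(I') improving on it; so the derivation halts.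
-- For correctness, the consistent models of the disjunction of τ are always exactly the
-- interpretations better than I (and all of them satisfy Δ). In a saturated state τ is empty,
-- since otherwise F-Close applies or, the branch not being unbounded, Optimize succeeds and
-- F-Sat applies; hence nothing is better than I.
{-# OPTIONS --safe #-}
module Submission where

open import Defs
open import Data.Nat using (suc; _≤_; s≤s)
open import Data.Nat.Properties using (≤-refl; m≤n⇒m≤1+n)
open import Data.List using ([]; _∷_; _++_; length)
open import Data.List.Relation.Unary.Any using (Any; here; there)
open import Data.List.Relation.Unary.Any.Properties using (++⁺ˡ; ++⁺ʳ; ++⁻; singleton⁻)
open import Data.Maybe using (Maybe; just; nothing)
open import Data.Product using (∃; _×_; _,_; proj₁; proj₂)
open import Data.Sum using (_⊎_; inj₁; inj₂)
open import Data.Empty using (⊥; ⊥-elim)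
open import Data.Unit using (tt)
open import Relation.Nullary using (¬_)
open import Relation.Binary.PropositionalEquality using (_≡_; _≢_; refl; cong; subst)
open import Relation.Binary.Construct.Closure.ReflexiveTransitive using (Star; ε; _◅_)
open import Relation.Binary.Structures using (IsStrictPartialOrder)
open import Function.Base using (_∘′_)
open import Function.Bundles using (Equivalence)

ψ∧ᶠχ≢ψ : ∀ {A : Set} (ψ χ : Formula A) → ψ ∧ᶠ χ ≢ ψ
ψ∧ᶠχ≢ψ (atom _)  _ ()
ψ∧ᶠχ≢ψ (ψ ∧ᶠ χ) _ eq = ψ∧ᶠχ≢ψ ψ χ (cong left eq)
  where
  left : ∀ {A} → Formula A → Formula A
  left (ψ ∧ᶠ _) = ψ
  left ψ        = ψ
ψ∧ᶠχ≢ψ (¬ᶠ _)    _ ()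

module HybridCalculus
    (T : Theory) (G : GOMT T)
    (Solve Optimize : Formula (Theory.Atom T) → Maybe (Theory.Interp T))
    (Better : Theory.Interp T → Formula (Theory.Atom T))
    (solve-spec : SolveSpec G Solve)
    (optimize-spec : OptimizeSpec G Optimize)
    (better-spec : BetterSpec G Better)
  where

  open Theory T
  open GOMT G
  open Hybrid G Solve Optimize Better
  open IsStrictPartialOrder ≺-spo using () renaming (trans to ≺-trans)
  open State

  private
    _⊨ᵀ_ : Interp → Formula Atom → Set
    _⊨ᵀ_ = _⊨_ T

  ⊨Better⇒≺ : ∀ {I J} → Consistent G I → Consistent G J → J ⊨ᵀ Better I → t J ≺ t I
  ⊨Better⇒≺ cI cJ J⊨BI = proj₂ (proj₂ (Equivalence.to (better-spec _ _ cI cJ) J⊨BI))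

  ≺⇒⊨Better : ∀ {I J} → Consistent G I → Consistent G J → t J ≺ t I → J ⊨ᵀ Better I
  ≺⇒⊨Better cI cJ J≺I = Equivalence.from (better-spec _ _ cI cJ) (cJ , cI , J≺I)

  optimum-unimprovable : ∀ {Δ I} → Optimize (φ ∧ᶠ Δ) ≡ just I →
                         ¬ Satisfiable T (φ ∧ᶠ (Δ ∧ᶠ Better I))
  optimum-unimprovable eq (J , cJ , J⊨Δ , J⊨BI) =
    let (cI , _) , I-minimal = proj₁ optimize-spec _ _ eq
    in  I-minimal J (cJ , J⊨Δ) (⊨Better⇒≺ cI cJ J⊨BI)

  Settled : State G → Set
  Settled s = τ s ≡ Δ s ∷ []

  Pops : State G → State G → Set
  Pops s s' = ∃ λ ψ → τ s ≡ ψ ∷ τ s'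

  non-split-pops-or-settles : ∀ {s s'} (st : Step s s') → ¬ IsSplit st → Pops s s' ⊎ Settled s'
  non-split-pops-or-settles (F-Split _ _ _ _) ¬split = ⊥-elim (¬split tt)
  non-split-pops-or-settles (F-Sat _ _ _)     _      = inj₂ refl
  non-split-pops-or-settles (F-Close _ _)     _      = inj₁ (_ , refl)

  empty-τ-stuck : ∀ {I Δ s} → ¬ Step ⟨ I , Δ , [] ⟩ s
  empty-τ-stuck ()

  settled-stuck-within-two-steps : ∀ {s s₁ s₂ s₃} → Settled s →
    (st₁ : Step s s₁) → ¬ IsSplit st₁ → (st₂ : Step s₁ s₂) → ¬ IsSplit st₂ → ¬ Step s₂ s₃
  settled-stuck-within-two-steps refl (F-Split _ _ _ _) ¬split _ _ _ = ¬split tt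
  settled-stuck-within-two-steps refl (F-Close _ _) _ st₂ _ _ = empty-τ-stuck st₂
  settled-stuck-within-two-steps refl (F-Sat _ _ _) _ (F-Split _ _ _ _) ¬split _ = ¬split tt
  settled-stuck-within-two-steps refl (F-Sat _ _ _) _ (F-Close _ _) _ st₃ = empty-τ-stuck st₃
  settled-stuck-within-two-steps refl (F-Sat _ eq₁ _) _ (F-Sat _ eq₂ _) _ _ =
    optimum-unimprovable eq₁ (_ , proj₁ (proj₁ optimize-spec _ _ eq₂))

  module _ (D : InfiniteDerivation) where
    open InfiniteDerivation D

    ¬settled-after-splits : ∀ n → splitBound ≤ n → ¬ Settled (d n)
    ¬settled-after-splits n b≤n settled =
      settled-stuck-within-two-steps settled
        (step n) (finSplits n b≤n)
        (step (suc n)) (finSplits (suc n) (m≤n⇒m≤1+n b≤n))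
        (step (suc (suc n)))

    ¬τ-bounded-after-splits : ∀ L n → splitBound ≤ n → ¬ length (τ (d n)) ≤ L
    ¬τ-bounded-after-splits L n b≤n |τ|≤L with non-split-pops-or-settles (step n) (finSplits n b≤n)
    ... | inj₂ settled = ¬settled-after-splits (suc n) (m≤n⇒m≤1+n b≤n) settled
    ... | inj₁ (_ , pop) = shrink L (subst (λ τ → length τ ≤ L) pop |τ|≤L)
      where
      shrink : ∀ L → suc (length (τ (d (suc n)))) ≤ L → ⊥
      shrink (suc L) (s≤s |τ'|≤L) = ¬τ-bounded-after-splits L (suc n) (m≤n⇒m≤1+n b≤n) |τ'|≤L

  no-infinite-derivation : ¬ InfiniteDerivation
  no-infinite-derivation D =
    ¬τ-bounded-after-splits D _ (InfiniteDerivation.splitBound D) ≤-refl ≤-refl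

  record Invariant (s : State G) : Set where
    field
      consistent : Consistent G (I s)
      ≺⇒Δ        : ∀ {J} → Consistent G J → t J ≺ t (I s) → J ⊨ᵀ Δ s
      τ⇒≺        : ∀ {J} → Consistent G J → Any (J ⊨ᵀ_) (τ s) → t J ≺ t (I s)
      ≺⇒τ        : ∀ {J} → Consistent G J → t J ≺ t (I s) → Any (J ⊨ᵀ_) (τ s)

  invariant-initial : ∀ {s} → IsInitial s → Invariant s
  invariant-initial (I₀ , eq , refl) = record
    { consistent = cI₀
    ; ≺⇒Δ        = ≺⇒⊨Better cI₀
    ; τ⇒≺        = λ cJ J⊨τ → ⊨Better⇒≺ cI₀ cJ (singleton⁻ J⊨τ)
    ; ≺⇒τ        = λ cJ J≺I₀ → here (≺⇒⊨Better cI₀ cJ J≺I₀)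
    }
    where
    cI₀ : Consistent G I₀
    cI₀ = proj₁ solve-spec φ I₀ eq

  invariant-step : ∀ {s s'} → Step s s' → Invariant s → Invariant s'
  invariant-step (F-Split {ψ = ψ} {rest} ψs _ ψ⇔ψs _) inv = record
    { consistent = consistent
    ; ≺⇒Δ        = ≺⇒Δ
    ; τ⇒≺        = λ cJ J⊨τ' → τ⇒≺ cJ (collapse cJ (++⁻ ψs J⊨τ'))
    ; ≺⇒τ        = λ cJ J≺I → expand cJ (≺⇒τ cJ J≺I)
    }
    where
    open Invariant inv
    collapse : ∀ {J} → Consistent G J → Any (J ⊨ᵀ_) ψs ⊎ Any (J ⊨ᵀ_) rest → Any (J ⊨ᵀ_) (ψ ∷ rest)
    collapse cJ (inj₁ J⊨ψs)   = here (Equivalence.from (ψ⇔ψs _ cJ) J⊨ψs)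
    collapse cJ (inj₂ J⊨rest) = there J⊨rest
    expand : ∀ {J} → Consistent G J → Any (J ⊨ᵀ_) (ψ ∷ rest) → Any (J ⊨ᵀ_) (ψs ++ rest)
    expand cJ (here J⊨ψ)     = ++⁺ˡ (Equivalence.to (ψ⇔ψs _ cJ) J⊨ψ)
    expand cJ (there J⊨rest) = ++⁺ʳ ψs J⊨rest
  invariant-step (F-Sat {I = I} {Δ} {ψ} I' eq _) inv = record
    { consistent = cI'
    ; ≺⇒Δ        = ≺⇒Δ'
    ; τ⇒≺        = λ cJ J⊨τ' → ⊨Better⇒≺ cI' cJ (proj₂ (singleton⁻ J⊨τ'))
    ; ≺⇒τ        = λ cJ J≺I' → here (≺⇒Δ' cJ J≺I')
    }
    where
    open Invariant inv
    I'⊨φ∧ψ : I' ⊨ᵀ (φ ∧ᶠ ψ)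
    I'⊨φ∧ψ = proj₁ (proj₁ optimize-spec _ _ eq)
    cI' : Consistent G I'
    cI' = proj₁ I'⊨φ∧ψ
    I'≺I : t I' ≺ t I
    I'≺I = τ⇒≺ cI' (here (proj₂ I'⊨φ∧ψ))
    ≺⇒Δ' : ∀ {J} → Consistent G J → t J ≺ t I' → J ⊨ᵀ (Δ ∧ᶠ Better I')
    ≺⇒Δ' cJ J≺I' = ≺⇒Δ cJ (≺-trans J≺I' I'≺I) , ≺⇒⊨Better cI' cJ J≺I'
  invariant-step (F-Close {ψ = ψ} {rest} eq _) inv = record
    { consistent = consistent
    ; ≺⇒Δ        = λ cJ J≺I → ≺⇒Δ cJ J≺I , λ J⊨ψ → closed (_ , cJ , J⊨ψ)
    ; τ⇒≺        = λ cJ J⊨τ' → τ⇒≺ cJ (there J⊨τ')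
    ; ≺⇒τ        = λ cJ J≺I → drop-closed cJ (≺⇒τ cJ J≺I)
    }
    where
    open Invariant inv
    closed : ¬ Satisfiable T (φ ∧ᶠ ψ)
    closed = proj₂ solve-spec _ eq
    drop-closed : ∀ {J} → Consistent G J → Any (J ⊨ᵀ_) (ψ ∷ rest) → Any (J ⊨ᵀ_) rest
    drop-closed cJ (here J⊨ψ)     = ⊥-elim (closed (_ , cJ , J⊨ψ))
    drop-closed cJ (there J⊨rest) = J⊨rest

  invariant-star : ∀ {s s'} → Star Step s s' → Invariant s → Invariant s'
  invariant-star ε          inv = inv
  invariant-star (st ◅ sts) inv = invariant-star sts (invariant-step st inv)

  saturated⇒τ≡[] : NotUnboundedAlongBranches → ∀ {s} → Reachable s → Saturated s → τ s ≡ []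
  saturated⇒τ≡[] bounded {⟨ I , Δ , [] ⟩}        _         _         = refl
  saturated⇒τ≡[] bounded {⟨ I , Δ , ψ ∷ rest ⟩} reachable saturated
    with Solve (φ ∧ᶠ ψ) in solved
  ... | nothing = ⊥-elim (saturated _ (F-Close solved (ψ∧ᶠχ≢ψ Δ (¬ᶠ ψ) ∘′ cong State.Δ)))
  ... | just J  with Optimize (φ ∧ᶠ ψ) in optimized
  ...   | nothing = ⊥-elim (proj₂ optimize-spec _ optimized
                      (bounded I Δ ψ rest reachable (J , proj₁ solve-spec _ J solved)))
  ...   | just I' = ⊥-elim (saturated _ (F-Sat I' optimized (ψ∧ᶠχ≢ψ Δ (Better I') ∘′ cong State.Δ)))

  saturated-reachable-optimal : NotUnboundedAlongBranches → ∀ {s} → Reachable s → Saturated s →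
                                Optimal G (I s)
  saturated-reachable-optimal bounded {s} reachable@(_ , initial , derivation) saturated =
    consistent , λ { J (cJ , _ , J≺I) → no-branch-left (≺⇒τ cJ J≺I) }
    where
    open Invariant (invariant-star derivation (invariant-initial initial))
    no-branch-left : ∀ {J} → ¬ Any (J ⊨ᵀ_) (τ s)
    no-branch-left rewrite saturated⇒τ≡[] bounded reachable saturated = λ ()

theorem4 : (T : Theory) (G : GOMT T)
    (Solve Optimize : Formula (Theory.Atom T) → Maybe (Theory.Interp T))
    (Better : Theory.Interp T → Formula (Theory.Atom T)) →
    SolveSpec G Solve → OptimizeSpec G Optimize → BetterSpec G Better →
    Satisfiable T (GOMT.φ G) →
    ∃ (λ I → Optimal G I) →
    Hybrid.NotUnboundedAlongBranches G Solve Optimize Better →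
    (¬ Hybrid.InfiniteDerivation G Solve Optimize Better)
    × (∀ s₀ s → Hybrid.IsInitial G Solve Optimize Better s₀ →
        Star (Hybrid.Step G Solve Optimize Better) s₀ s →
        Hybrid.Saturated G Solve Optimize Better s →
        Optimal G (State.I s))
theorem4 T G Solve Optimize Better solve-spec optimize-spec better-spec _ _ bounded =
  no-infinite-derivation ,
  λ s₀ _ initial derivation → saturated-reachable-optimal bounded (s₀ , initial , derivation)
  where
  open HybridCalculus T G Solve Optimize Better solve-spec optimize-spec better-spec
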